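{- Let $R$ be a commutative ring with unity which is not an integral domain, such that $R$ has finitely many minimal prime ideals and $Z(R)$ is a union of finitely many ideals of $R$. Then the following are equivalent: (i) $R$ is finite; (ii) $\chi(Reg(\mathbb{CAY}(R)))$ is finite; (iii) $\omega(Reg(\mathbb{CAY}(R)))$ is finite; (iv) $Reg(\mathbb{CAY}(R))$ has no infinite clique.
   Context: $Z(R)$ is the set of zero-divisors of $R$ (including $0$), $Reg(R)=R\setminus Z(R)$. $\mathbb{CAY}(R)$ is the graph with vertex set $R$ in which distinct $x,y$ are adjacent iff $x-y\in Z(R)$, and $Reg(\mathbb{CAY}(R))$ is its induced subgraph on $Reg(R)$. $\chi$ and $\omega$ denote chromatic number and clique number (supremum of clique sizes). -}

module Defs where

open import Level using (Level; _⊔_) renaming (suc to lsuc)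
open import Algebra.Bundles using (CommutativeRing)
open import Data.Nat using (ℕ; _≤_)
open import Data.Fin using (Fin)
open import Data.List using (List)
open import Data.List.Relation.Unary.Any using (Any)
open import Data.Product using (Σ; ∃; _×_; _,_)
open import Data.Sum using (_⊎_)
open import Relation.Nullary using (¬_)
open import Relation.Binary.PropositionalEquality using (_≡_)
open import Function.Bundles using (_⇔_)

module RingDefs {c ℓ : Level} (R : CommutativeRing c ℓ) where
  open CommutativeRing R

  record Ideal : Set (lsuc (c ⊔ ℓ)) where
    field
      mem      : Carrier → Set (c ⊔ ℓ)
      resp     : ∀ {x y} → x ≈ y → mem x → mem y
      has0     : mem 0#
      closed+  : ∀ {x y} → mem x → mem y → mem (x + y)
      closed*  : ∀ r {x} → mem x → mem (r * x)
  open Ideal public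

  _⊆I_ : Ideal → Ideal → Set (c ⊔ ℓ)
  I ⊆I J = ∀ x → mem I x → mem J x

  _≐I_ : Ideal → Ideal → Set (c ⊔ ℓ)
  I ≐I J = (I ⊆I J) × (J ⊆I I)

  IsPrime : Ideal → Set (c ⊔ ℓ)
  IsPrime P = (¬ mem P 1#) × (∀ a b → mem P (a * b) → mem P a ⊎ mem P b)

  IsMinimalPrime : Ideal → Set (lsuc (c ⊔ ℓ))
  IsMinimalPrime P = IsPrime P × (∀ Q → IsPrime Q → Q ⊆I P → P ⊆I Q)

  FinitelyManyMinimalPrimes : Set (lsuc (c ⊔ ℓ))
  FinitelyManyMinimalPrimes =
    Σ (List Ideal) λ Ps → ∀ P → IsMinimalPrime P → Any (λ Q → P ≐I Q) Ps

  IsIntegralDomain : Set (c ⊔ ℓ)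
  IsIntegralDomain = (¬ 1# ≈ 0#) × (∀ a b → a * b ≈ 0# → a ≈ 0# ⊎ b ≈ 0#)

  Z : Carrier → Set (c ⊔ ℓ)
  Z x = x ≈ 0# ⊎ Σ Carrier (λ y → (¬ y ≈ 0#) × (x * y ≈ 0#))

  Reg : Carrier → Set (c ⊔ ℓ)
  Reg x = ¬ Z x

  ZFiniteUnionOfIdeals : Set (lsuc (c ⊔ ℓ))
  ZFiniteUnionOfIdeals =
    Σ (List Ideal) λ Is → ∀ x → Z x ⇔ Any (λ I → mem I x) Is

  IsFinite : Set (c ⊔ ℓ)
  IsFinite = Σ ℕ λ n → Σ (Fin n → Carrier) λ f →
    (∀ i j → f i ≈ f j → i ≡ j) × (∀ x → Σ (Fin n) λ i → f i ≈ x)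

  -- Vertices of Reg(CAY(R)) are elements of Reg(R); distinct x,y adjacent iff x - y ∈ Z(R)
  RegV : Set (c ⊔ ℓ)
  RegV = Σ Carrier Reg

  Adj : RegV → RegV → Set (c ⊔ ℓ)
  Adj (x , _) (y , _) = (¬ x ≈ y) × Z (x - y)

  ChromaticFinite : Set (c ⊔ ℓ)
  ChromaticFinite = Σ ℕ λ n → Σ (RegV → Fin n) λ col →
    (∀ u v → Data.Product.proj₁ u ≈ Data.Product.proj₁ v → col u ≡ col v) ×
    (∀ u v → Adj u v → ¬ col u ≡ col v)

  Clique : ℕ → Set (c ⊔ ℓ)
  Clique m = Σ (Fin m → RegV) λ f → ∀ i j → ¬ i ≡ j → Adj (f i) (f j)

  CliqueNumberFinite : Set (c ⊔ ℓ)
  CliqueNumberFinite = Σ ℕ λ n → ∀ m → Clique m → m ≤ n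

  InfiniteClique : Set (c ⊔ ℓ)
  InfiniteClique = Σ (ℕ → RegV) λ f → ∀ i j → ¬ i ≡ j → Adj (f i) (f j)

-- Colouring each vertex by itself and the pigeonhole principle give (i) ⇒ (ii) ⇒ (iii) ⇒ (iv).
-- For (iv) ⇒ (i): if the translates u + a of the elements of a set P are regular and the
-- differences a − b are zero-divisors, the translates form a clique, so without infinite cliques P is (classically) finite.
-- Let K ⊆ Z(R) be an ideal. Its elements a with 1 + a regular form such a set; those with
-- 1 + a in one of the ideals I covering Z(R) form a coset of K ∩ I, and K ∩ I is finite by
-- induction on the number of covering ideals, since 1 ∉ I lets I drop out of the cover of
-- 1 + (K ∩ I). Hence Z(R) is finite. Finally a nonzero zero-divisor z makes R finite: x ↦ xz
-- maps R into Z(R), and its fibres are cosets of Ann(z) ⊆ Z(R).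
module Submission where

open import Defs
open import Level using (_⊔_; Lift; lift; lower) renaming (suc to lsuc)
open import Algebra.Bundles using (CommutativeRing)
open import Axiom.ExcludedMiddle using (ExcludedMiddle)
open import Axiom.DoubleNegationElimination using (em⇒dne)
open import Data.Empty using (⊥-elim)
open import Data.Fin using (Fin; zero; suc; toℕ)
import Data.Fin.Properties as Fin
open import Data.List using (List; []; _∷_; _++_; length; lookup; map; deduplicate)
open import Data.List.Properties using (length-removeAt′)
open import Data.List.Relation.Unary.Any as Any using (Any; here; there; index; _─_)
open import Data.List.Relation.Unary.Any.Properties using (lookup-index)
open import Data.List.Relation.Unary.All as All using (All; []; _∷_)
open import Data.List.Relation.Unary.All.Properties using (─⁺)
import Data.List.Membership.Propositional as Prop
open import Data.List.Membership.Propositional.Properties using (∈-lookup)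
open import Data.Nat using (ℕ; zero; suc; _≤_; _<_)
import Data.Nat.Properties as ℕ
open import Data.Nat.Induction using (<-wellFounded)
open import Induction.WellFounded using (Acc; acc)
open import Data.Product using (Σ; ∃; _×_; _,_; proj₁; proj₂)
open import Data.Sum using (_⊎_; inj₁; inj₂; [_,_]′)
open import Function using (_∘_)
open import Function.Bundles using (_⇔_; mk⇔; Equivalence)
open import Relation.Binary.Bundles using (Setoid; DecSetoid)
open import Relation.Binary.Definitions using (tri<; tri≈; tri>)
open import Relation.Binary.PropositionalEquality using (_≡_; _≢_; refl; cong) renaming (sym to ≡-sym)
open import Relation.Nullary using (¬_; yes; no)
open import Relation.Nullary.Decidable using (map′)
open import Relation.Unary using (Pred; _⊆_; _∪_; U)

module _ {a p} {A : Set a} {P : Pred A p} where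

  Any-─⁺ : ∀ {x xs} (x∈xs : x Prop.∈ xs) → Any P xs → ¬ P x → Any P (xs ─ x∈xs)
  Any-─⁺ (here refl)  (here px)   ¬px = ⊥-elim (¬px px)
  Any-─⁺ (here refl)  (there pxs) _   = pxs
  Any-─⁺ (there _)    (here px)   _   = here px
  Any-─⁺ (there x∈xs) (there pxs) ¬px = there (Any-─⁺ x∈xs pxs ¬px)

  length-─ : ∀ {xs} (pxs : Any P xs) → length (xs ─ pxs) < length xs
  length-─ {xs} pxs = ℕ.≤-reflexive (≡-sym (length-removeAt′ xs (index pxs)))

lower-em : ∀ {a b} → ExcludedMiddle (a ⊔ b) → ExcludedMiddle a
lower-em {b = b} em {P} = map′ lower lift (em {Lift b P})

module SetoidListability {a ℓ} (S : Setoid a ℓ) where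
  open Setoid S using (Carrier; _≈_; _≉_; sym; isEquivalence) renaming (refl to ≈-refl)
  open import Data.List.Membership.Setoid S using (_∈_; _∉_)
  open import Data.List.Membership.Setoid.Properties using (∈-resp-≈; ∈-++⁺ˡ; ∈-++⁺ʳ)
  open import Data.List.Relation.Unary.Unique.Setoid S using (Unique; _∷_)
  open import Data.List.Relation.Unary.Unique.DecSetoid.Properties using (deduplicate-!)
  open import Data.List.Relation.Unary.Enumerates.Setoid.Properties using (deduplicate⁺)

  Listable : ∀ {p} → Pred Carrier p → Set (a ⊔ ℓ ⊔ p)
  Listable P = ∃ λ xs → P ⊆ (_∈ xs)

  module _ {p q} {P : Pred Carrier p} {Q : Pred Carrier q} where

    listable-⊆ : Q ⊆ P → Listable P → Listable Q
    listable-⊆ Q⊆P (xs , P⊆xs) = xs , P⊆xs ∘ Q⊆P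

    listable-∪ : Listable P → Listable Q → Listable (P ∪ Q)
    listable-∪ (xs , P⊆xs) (ys , Q⊆ys) = xs ++ ys , [ ∈-++⁺ˡ S ∘ P⊆xs , ∈-++⁺ʳ S xs ∘ Q⊆ys ]′

  listable-⋃ : ∀ {i p} {I : Set i} {P : I → Pred Carrier p} {is : List I} →
               All (λ i → Listable (P i)) is → Listable (λ x → Any (λ i → P i x) is)
  listable-⋃ []       = [] , λ ()
  listable-⋃ (L ∷ Ls) = listable-⊆ Any.toSum (listable-∪ L (listable-⋃ Ls))

  unique⇒lookup-injective : ∀ {xs} → Unique xs → ∀ i j → lookup xs i ≈ lookup xs j → i ≡ j
  unique⇒lookup-injective (_ ∷ _)     zero    zero    _ = refl
  unique⇒lookup-injective (x≉xs ∷ _)  zero    (suc j) e = ⊥-elim (All.lookup x≉xs (∈-lookup j) e)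
  unique⇒lookup-injective (x≉xs ∷ _)  (suc i) zero    e = ⊥-elim (All.lookup x≉xs (∈-lookup i) (sym e))
  unique⇒lookup-injective (_ ∷ uniq)  (suc i) (suc j) e = cong suc (unique⇒lookup-injective uniq i j e)

  module _ (em : ExcludedMiddle (a ⊔ ℓ)) where

    decSetoid : DecSetoid a ℓ
    decSetoid = record
      { isDecEquivalence = record { isEquivalence = isEquivalence ; _≟_ = λ _ _ → lower-em {b = a} em } }

    listable⇒finite : Listable U →
      Σ ℕ λ n → Σ (Fin n → Carrier) λ f →
        (∀ i j → f i ≈ f j → i ≡ j) × (∀ x → Σ (Fin n) λ i → f i ≈ x)
    listable⇒finite (xs , U⊆xs) =
      length ys , lookup ys , unique⇒lookup-injective (deduplicate-! decSetoid xs) ,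
      λ x → index (enumerates x) , sym (lookup-index (enumerates x))
      where
      ys : List Carrier
      ys = deduplicate (DecSetoid._≟_ decSetoid) xs

      enumerates : ∀ x → x ∈ ys
      enumerates = deduplicate⁺ decSetoid (λ x → U⊆xs _)

    module _ {P : Pred Carrier (a ⊔ ℓ)} (unlistable : ¬ Listable P) where
      private
        fresh : ∀ xs → ∃ λ x → P x × x ∉ xs
        fresh xs = em⇒dne em λ none →
          unlistable (xs , λ {x} Px → em⇒dne em λ x∉xs → none (x , Px , x∉xs))

        prefix : ℕ → List Carrier
        prefix zero    = []
        prefix (suc n) = proj₁ (fresh (prefix n)) ∷ prefix n

        term : ℕ → Carrier
        term n = proj₁ (fresh (prefix n))

        earlier∈prefix : ∀ {m n} → m < n → term m ∈ prefix n
        earlier∈prefix {m} {suc n} m<1+n with ℕ.m<1+n⇒m<n∨m≡n m<1+n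
        ... | inj₁ m<n  = there (earlier∈prefix m<n)
        ... | inj₂ refl = here ≈-refl

        term-distinct : ∀ {m n} → m < n → term m ≉ term n
        term-distinct {n = n} m<n tm≈tn =
          proj₂ (proj₂ (fresh (prefix n))) (∈-resp-≈ S tm≈tn (earlier∈prefix m<n))

      unlistable⇒injective-sequence :
        Σ (ℕ → Carrier) λ f → (∀ n → P (f n)) × (∀ m n → m ≢ n → f m ≉ f n)
      unlistable⇒injective-sequence = term , (λ n → proj₁ (proj₂ (fresh (prefix n)))) , distinct
        where
        distinct : ∀ m n → m ≢ n → term m ≉ term n
        distinct m n m≢n with ℕ.<-cmp m n
        ... | tri< m<n _ _ = term-distinct m<n
        ... | tri≈ _ m≡n _ = ⊥-elim (m≢n m≡n)
        ... | tri> _ _ n<m = term-distinct n<m ∘ sym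

module RingFacts {c ℓ} (R : CommutativeRing c ℓ) where
  open CommutativeRing R
  open RingDefs R
  open SetoidListability setoid using (Listable)
  open import Algebra.Properties.Ring ring using (-1*x≈-x; [y-z]x≈yx-zx)
  open import Algebra.Properties.AbelianGroup +-abelianGroup
    using (⁻¹-∙-comm; x≈y⇒x∙y⁻¹≈ε; //-rightDividesˡ)
  open import Algebra.Properties.CommutativeSemigroup +-commutativeSemigroup using (interchange)
  open import Data.List.Membership.Setoid.Properties using (∈-resp-≈; ∈-map⁺)
  open import Relation.Binary.Reasoning.Setoid setoid

  [u+x]-[u+y]≈x-y : ∀ u x y → (u + x) - (u + y) ≈ x - y
  [u+x]-[u+y]≈x-y u x y = begin
    (u + x) - (u + y)      ≈⟨ +-congˡ (⁻¹-∙-comm u y) ⟨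
    (u + x) + (- u + - y)  ≈⟨ interchange u x (- u) (- y) ⟩
    (u - u) + (x - y)      ≈⟨ +-congʳ (-‿inverseʳ u) ⟩
    0# + (x - y)           ≈⟨ +-identityˡ (x - y) ⟩
    x - y                  ∎

  trivial⇒≈0 : 1# ≈ 0# → ∀ x → x ≈ 0#
  trivial⇒≈0 1≈0 x = begin
    x       ≈⟨ *-identityʳ x ⟨
    x * 1#  ≈⟨ *-congˡ 1≈0 ⟩
    x * 0#  ≈⟨ zeroʳ x ⟩
    0#      ∎

  _∩_ : Ideal → Ideal → Ideal
  K ∩ I = record
    { mem     = λ x → mem K x × mem I x
    ; resp    = λ x≈y (Kx , Ix) → resp K x≈y Kx , resp I x≈y Ix
    ; has0    = has0 K , has0 I
    ; closed+ = λ (Kx , Ix) (Ky , Iy) → closed+ K Kx Ky , closed+ I Ix Iy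
    ; closed* = λ r (Kx , Ix) → closed* K r Kx , closed* I r Ix
    }

  closed- : ∀ (I : Ideal) {x y} → mem I x → mem I y → mem I (x - y)
  closed- I Ix Iy = closed+ I Ix (resp I (-1*x≈-x _) (closed* I (- 1#) Iy))

  Z-resp : ∀ {x y} → x ≈ y → Z x → Z y
  Z-resp x≈y (inj₁ x≈0)               = inj₁ (trans (sym x≈y) x≈0)
  Z-resp x≈y (inj₂ (w , w≉0 , xw≈0)) = inj₂ (w , w≉0 , trans (*-congʳ (sym x≈y)) xw≈0)

  Z-*ˡ : ∀ x {z} → Z z → Z (x * z)
  Z-*ˡ x (inj₁ z≈0)               = inj₁ (trans (*-congˡ z≈0) (zeroʳ x))
  Z-*ˡ x (inj₂ (w , w≉0 , zw≈0)) =
    inj₂ (w , w≉0 , trans (*-assoc x _ w) (trans (*-congˡ zw≈0) (zeroʳ x)))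

  xz≈yz⇒Z[x-y] : ∀ {x y z} → ¬ z ≈ 0# → x * z ≈ y * z → Z (x - y)
  xz≈yz⇒Z[x-y] {x} {y} {z} z≉0 xz≈yz = inj₂ (z , z≉0 , (begin
    (x - y) * z    ≈⟨ [y-z]x≈yx-zx z x y ⟩
    x * z - y * z  ≈⟨ x≈y⇒x∙y⁻¹≈ε xz≈yz ⟩
    0#             ∎))

  1∉Z : ¬ 1# ≈ 0# → ¬ Z 1#
  1∉Z 1≉0 (inj₁ 1≈0)               = 1≉0 1≈0
  1∉Z 1≉0 (inj₂ (w , w≉0 , 1w≈0)) = w≉0 (trans (sym (*-identityˡ w)) 1w≈0)

  listable-by-differences : ∀ {d s} {D : Pred Carrier d} {S : Pred Carrier s} →
    ExcludedMiddle (c ⊔ s) → Listable D → (∀ {x y} → S x → S y → D (x - y)) → Listable S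
  listable-by-differences {S = S} em (ds , D⊆ds) S-D with em {∃ S}
  ... | no ∄S         = [] , λ Sx → ⊥-elim (∄S (_ , Sx))
  ... | yes (s₀ , Ss₀) = map (s₀ +_) ds , λ {x} Sx →
    ∈-resp-≈ setoid (trans (+-comm s₀ (x - s₀)) (//-rightDividesˡ s₀ x))
      (∈-map⁺ setoid setoid +-congˡ (D⊆ds (S-D Sx Ss₀)))

module RegularCayleyGraph {c ℓ} (R : CommutativeRing c ℓ) where
  open CommutativeRing R hiding (refl)
  open RingDefs R

  finite⇒chromaticFinite : IsFinite → ChromaticFinite
  finite⇒chromaticFinite (n , f , f-injective , f-surjective) = n , colour , colour-resp , colour-proper
    where
    colour : RegV → Fin n
    colour (x , _) = proj₁ (f-surjective x)

    colour-resp : ∀ u v → proj₁ u ≈ proj₁ v → colour u ≡ colour v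
    colour-resp (x , _) (y , _) x≈y = f-injective _ _
      (trans (proj₂ (f-surjective x)) (trans x≈y (sym (proj₂ (f-surjective y)))))

    colour-proper : ∀ u v → Adj u v → ¬ colour u ≡ colour v
    colour-proper (x , _) (y , _) (x≉y , _) same = x≉y
      (trans (sym (proj₂ (f-surjective x))) (trans (reflexive (cong f same)) (proj₂ (f-surjective y))))

  chromaticFinite⇒cliqueNumberFinite : ChromaticFinite → CliqueNumberFinite
  chromaticFinite⇒cliqueNumberFinite (n , colour , _ , colour-proper) = n , bound
    where
    bound : ∀ m → Clique m → m ≤ n
    bound m (f , adjacent) with m ℕ.≤? n
    ... | yes m≤n = m≤n
    ... | no m≰n with Fin.pigeonhole (ℕ.≰⇒> m≰n) (colour ∘ f)
    ... | i , j , i<j , same = ⊥-elim (colour-proper (f i) (f j) (adjacent i j (Fin.<⇒≢ i<j)) same)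

  cliqueNumberFinite⇒¬infiniteClique : CliqueNumberFinite → ¬ InfiniteClique
  cliqueNumberFinite⇒¬infiniteClique (n , bound) (f , adjacent) = ℕ.<-irrefl refl
    (bound (suc n) (f ∘ toℕ , λ i j i≢j → adjacent _ _ (i≢j ∘ Fin.toℕ-injective)))

module Classical {c ℓ} (em : ExcludedMiddle (c ⊔ ℓ)) (R : CommutativeRing c ℓ) where
  open CommutativeRing R hiding (refl)
  open RingDefs R
  open RingFacts R
  open SetoidListability setoid
  open import Algebra.Properties.AbelianGroup +-abelianGroup using (∙-cancelˡ; //-rightDividesʳ)

  trivial⊎zeroDivisor : ¬ IsIntegralDomain → 1# ≈ 0# ⊎ ∃ λ z → ¬ z ≈ 0# × Z z
  trivial⊎zeroDivisor ¬domain = em⇒dne em λ neither →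
    ¬domain ((neither ∘ inj₁) , λ x y xy≈0 → em⇒dne (lower-em {b = c} em) λ ¬x≈0⊎y≈0 →
      neither (inj₂ (x , ¬x≈0⊎y≈0 ∘ inj₁ , inj₂ (y , ¬x≈0⊎y≈0 ∘ inj₂ , xy≈0))))

  translate-clique-listable : ¬ InfiniteClique → ∀ u {P : Pred Carrier (c ⊔ ℓ)} →
    (∀ {a} → P a → Reg (u + a)) → (∀ {a b} → P a → P b → Z (a - b)) → Listable P
  translate-clique-listable noClique u {P} P-reg P-Z = em⇒dne em λ unlistable →
    let (f , Pf , f-distinct) = unlistable⇒injective-sequence em unlistable in
    noClique ((λ n → u + f n , P-reg (Pf n)) , λ m n m≢n →
      f-distinct m n m≢n ∘ ∙-cancelˡ u _ _ ,
      Z-resp (sym ([u+x]-[u+y]≈x-y u _ _)) (P-Z (Pf m) (Pf n)))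

  translate∈ideal-listable : ∀ u (K I : Ideal) →
    Listable (mem (K ∩ I)) → Listable (λ a → mem K a × mem I (u + a))
  translate∈ideal-listable u K I K∩I-listable = listable-by-differences em K∩I-listable
    λ (Ka , Iua) (Kb , Iub) → closed- K Ka Kb , resp I ([u+x]-[u+y]≈x-y u _ _) (closed- I Iua Iub)

  1+_∩Z⊆⋃_ : Ideal → List Ideal → Set (lsuc (c ⊔ ℓ))
  1+ K ∩Z⊆⋃ Bs = ∀ {a} → mem K a → Z (1# + a) → Any (λ I → mem I (1# + a)) Bs

  ∩Z⊆⋃-─ : ∀ {K I Bs} (I∈Bs : I Prop.∈ Bs) → ¬ mem I 1# →
    1+ K ∩Z⊆⋃ Bs → 1+ (K ∩ I) ∩Z⊆⋃ (Bs ─ I∈Bs)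
  ∩Z⊆⋃-─ {I = I} I∈Bs 1∉I cover (Ka , Ia) Z[1+a] = Any-─⁺ I∈Bs (cover Ka Z[1+a])
    λ I[1+a] → 1∉I (resp I (//-rightDividesʳ _ 1#) (closed- I I[1+a] Ia))

  ideal-listable : ¬ InfiniteClique → ∀ Bs → Acc _<_ (length Bs) → All (λ I → ¬ mem I 1#) Bs →
    ∀ K → mem K ⊆ Z → 1+ K ∩Z⊆⋃ Bs → Listable (mem K)
  ideal-listable noClique Bs (acc smaller) 1∉Bs K K⊆Z cover =
    listable-⊆ split (listable-∪ regularPart (listable-⋃ (All.tabulate singularPart)))
    where
    regularPart : Listable (λ a → mem K a × Reg (1# + a))
    regularPart = translate-clique-listable noClique 1# proj₂
      λ (Ka , _) (Kb , _) → K⊆Z (closed- K Ka Kb)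

    singularPart : ∀ {I} → I Prop.∈ Bs → Listable (λ a → mem K a × mem I (1# + a))
    singularPart {I} I∈Bs = translate∈ideal-listable 1# K I
      (ideal-listable noClique (Bs ─ I∈Bs) (smaller (length-─ I∈Bs)) (─⁺ I∈Bs 1∉Bs)
        (K ∩ I) (λ (Ka , _) → K⊆Z Ka) (∩Z⊆⋃-─ {K = K} I∈Bs (All.lookup 1∉Bs I∈Bs) cover))

    split : mem K ⊆ (λ a → mem K a × Reg (1# + a)) ∪ (λ a → Any (λ I → mem K a × mem I (1# + a)) Bs)
    split {a} Ka with em {Z (1# + a)}
    ... | no  reg     = inj₁ (Ka , reg)
    ... | yes Z[1+a] = inj₂ (Any.map (Ka ,_) (cover Ka Z[1+a]))

  Z-listable : ¬ 1# ≈ 0# → ¬ InfiniteClique → ZFiniteUnionOfIdeals → Listable Z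
  Z-listable 1≉0 noClique (Is , Z⇔⋃Is) =
    listable-⊆ (Equivalence.to (Z⇔⋃Is _)) (listable-⋃ (All.tabulate member-listable))
    where
    member⊆Z : ∀ {I} → I Prop.∈ Is → mem I ⊆ Z
    member⊆Z I∈Is {x} Ix = Equivalence.from (Z⇔⋃Is x) (Any.map (λ { refl → Ix }) I∈Is)

    member-listable : ∀ {I} → I Prop.∈ Is → Listable (mem I)
    member-listable {I} I∈Is = ideal-listable noClique Is (<-wellFounded _)
      (All.tabulate (λ J∈Is → 1∉Z 1≉0 ∘ member⊆Z J∈Is)) I (member⊆Z I∈Is)
      (λ _ → Equivalence.to (Z⇔⋃Is _))

  Z-listable⇒listable : Listable Z → ∀ {z} → ¬ z ≈ 0# → Z z → Listable U
  Z-listable⇒listable Z-list@(zs , Z⊆zs) {z} z≉0 Zz =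
    listable-⊆ (λ {x} _ → Z⊆zs (Z-*ˡ x Zz)) (listable-⋃ (All.universal fibre-listable zs))
    where
    fibre-listable : ∀ e → Listable (λ x → x * z ≈ e)
    fibre-listable e = listable-by-differences em Z-list
      λ xz≈e yz≈e → xz≈yz⇒Z[x-y] z≉0 (trans xz≈e (sym yz≈e))

  ¬infiniteClique⇒finite : ¬ IsIntegralDomain → ZFiniteUnionOfIdeals → ¬ InfiniteClique → IsFinite
  ¬infiniteClique⇒finite ¬domain Z-union noClique with trivial⊎zeroDivisor ¬domain
  ... | inj₁ 1≈0 = listable⇒finite em (0# ∷ [] , λ {x} _ → here (trivial⇒≈0 1≈0 x))
  ... | inj₂ (z , z≉0 , Zz) = listable⇒finite em
    (Z-listable⇒listable (Z-listable (λ 1≈0 → z≉0 (trivial⇒≈0 1≈0 z)) noClique Z-union) z≉0 Zz)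

mainTheorem4 : ∀ {c ℓ} → ExcludedMiddle (c ⊔ ℓ) → (R : CommutativeRing c ℓ) →
    let open RingDefs R in
    ¬ IsIntegralDomain → FinitelyManyMinimalPrimes → ZFiniteUnionOfIdeals →
    (IsFinite ⇔ ChromaticFinite) × (IsFinite ⇔ CliqueNumberFinite) ×
    (IsFinite ⇔ (¬ InfiniteClique))
mainTheorem4 em R ¬domain _ Z-union =
  mk⇔ i⇒ii (iv⇒i ∘ iii⇒iv ∘ ii⇒iii) ,
  mk⇔ (ii⇒iii ∘ i⇒ii) (iv⇒i ∘ iii⇒iv) ,
  mk⇔ (iii⇒iv ∘ ii⇒iii ∘ i⇒ii) iv⇒i
  where
  open RegularCayleyGraph R renaming
    ( finite⇒chromaticFinite             to i⇒ii
    ; chromaticFinite⇒cliqueNumberFinite to ii⇒iii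
    ; cliqueNumberFinite⇒¬infiniteClique to iii⇒iv )
  open RingDefs R
  open Classical em R using (¬infiniteClique⇒finite)

  iv⇒i : ¬ InfiniteClique → IsFinite
  iv⇒i = ¬infiniteClique⇒finite ¬domain Z-union
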